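{- The vector space $\mathbb{K}\mathcal{P}=\bigoplus_{n\ge 0}\mathbb{K}\{M_a : a\in P_n\}$ (with $M_\epsilon=1$) is a cocommutative coalgebra when equipped with: - the coproduct $\Delta$ defined in the context; - the counit $\varepsilon$ given by $\varepsilon(M_\epsilon)=1$ and $\varepsilon(M_a)=0$ for every nonempty parking function $a$.
   Context: $\mathbb{K}$ is a field of characteristic zero. Words. Words are finite words on positive integers, and $\epsilon$ is the empty word. Parking functions. A word $a\in[n]^n$ is a parking function of length $n$ if its nondecreasing rearrangement $b_1\le\cdots\le b_n$ satisfies $b_i\le i$ for all $i$. $P_n$ is the set of such words, and $P_0=\{\epsilon\}$. LR-decomposition. Let $a=a_1\cdots a_n$ be nonempty. A position $i$ is a left-to-right minimum if $i=1$, or if $a_i<a_j$ for all $j<i$. Let $i_1<\cdots<i_s$ be these positions and $i_{s+1}=n+1$. Set $w_j=a_{i_{s+1-j}}\cdots a_{i_{s+2-j}-1}$ for $1\le j\le s$. Then $F_a=(w_1,\dots,w_s)$ (so $a=w_s\cdots w_1$), and $F_\epsilon=()$. $F_a$ is identified with the set of its words. For $S\subseteq F_a$, the subword $a'$ of $a$ with $F_{a'}=S$ is the concatenation of the words of $S$ in decreasing order of their (first, minimal) letters. Parkization. For a word $a=a_1\cdots a_n$ put $d(a)=\min\{i: |\{j:a_j\le i\}|<i\}$. If $d(a)=n+1$, then ${\rm Park}(a)=a$. Otherwise ${\rm Park}(a)={\rm Park}(\bar a)$, where $\bar a$ is obtained by decreasing by $1$ every letter greater than $d(a)$. Also ${\rm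 Park}(\epsilon)=\epsilon$. Coproduct. $\Delta(M_a)=\sum M_{{\rm Park}(a')}\otimes M_{{\rm Park}(a'')}$, over ordered pairs $(a',a'')$ of subwords of $a$ with $F_{a'}\cap F_{a''}=\emptyset$ and $F_{a'}\cup F_{a''}=F_a$. -}

module Defs where

open import Level using (Level; _⊔_)
open import Data.Nat using (ℕ; zero; suc; _∸_; _≤_; _<_; _≤ᵇ_; _<ᵇ_)
open import Data.Nat.Properties using (≤-decTotalOrder)
import Data.Nat as ℕ
open import Data.Bool using (Bool; true; false; if_then_else_; _∧_)
open import Data.List using (List; []; _∷_; length; map; concat; reverse; _++_)
open import Data.Nat.ListAction using (sum)
open import Data.List.Relation.Unary.All using (All)
open import Data.List.Properties using (≡-dec)
open import Data.Product using (_×_; _,_; Σ)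
open import Data.Unit using (⊤)
open import Relation.Nullary using (¬_; does)
open import Relation.Binary.PropositionalEquality using (_≡_)
open import Algebra.Bundles using (CommutativeRing)
open import Data.List.Sort.InsertionSort ≤-decTotalOrder using (sort)

-- Words: finite words on positive integers, represented as List ℕ.

Word : Set
Word = List ℕ

_≟w_ : (u v : Word) → Bool
u ≟w v = does (≡-dec ℕ._≟_ u v)

bounded : ℕ → Word → Set
bounded i []       = ⊤
bounded i (b ∷ bs) = b ≤ i × bounded (suc i) bs

IsParking : Word → Set
IsParking a = All (λ x → 1 ≤ x × x ≤ length a) a × bounded 1 (sort a)

-- go m acc rest : m = current minimum, acc = current block (reversed)
lrGo : ℕ → Word → Word → List Word
lrGo m acc []       = reverse acc ∷ []
lrGo m acc (y ∷ ys) = if y <ᵇ m then reverse acc ∷ lrGo y (y ∷ []) ys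
                                 else lrGo m (y ∷ acc) ys

-- blocks of a in left-to-right order: (w_s , … , w_1)
lrBlocks : Word → List Word
lrBlocks []       = []
lrBlocks (x ∷ xs) = lrGo x (x ∷ []) xs

-- F_a = (w_1 , … , w_s)  (so a = w_s ⋯ w_1)
F : Word → List Word
F a = reverse (lrBlocks a)

splits : List Word → List (List Word × List Word)
splits []       = ([] , []) ∷ []
splits (w ∷ ws) = map (λ { (l , r) → (w ∷ l , r) }) (splits ws)
               ++ map (λ { (l , r) → (l , w ∷ r) }) (splits ws)

-- subword a' of a with F_{a'} = S, S listed in the order of F_a
-- (increasing first letters): concatenate in decreasing order.
subwordOf : List Word → Word
subwordOf S = concat (reverse S)

countLe : ℕ → Word → ℕ
countLe i []       = 0
countLe i (x ∷ xs) = if x ≤ᵇ i then suc (countLe i xs) else countLe i xs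

-- first i ≥ i₀ with |{j : a_j ≤ i}| < i; fuel k; at fuel 0 returns i
dSearch : ℕ → ℕ → Word → ℕ
dSearch zero    i a = i
dSearch (suc k) i a = if countLe i a <ᵇ i then i else dSearch k (suc i) a

-- d(a) = min{ i : |{j : a_j ≤ i}| < i }  (always ≤ n+1)
d : Word → ℕ
d a = dSearch (length a) 1 a

lower : ℕ → Word → Word
lower e a = map (λ x → if e <ᵇ x then x ∸ 1 else x) a

-- each non-trivial step strictly decreases the sum of the letters,
-- so fuel (suc (sum a)) suffices
parkFuel : ℕ → Word → Word
parkFuel zero    a = a
parkFuel (suc k) a = if d a ℕ.≡ᵇ suc (length a) then a else parkFuel k (lower (d a) a)

Park : Word → Word
Park a = parkFuel (suc (sum a)) a

-- Coproduct on basis elements, as the list of terms M_b ⊗ M_c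
-- (each with coefficient 1)

Δ : Word → List (Word × Word)
Δ a = map (λ { (l , r) → (Park (subwordOf l) , Park (subwordOf r)) }) (splits (F a))

module _ {c ℓ : Level} (K : CommutativeRing c ℓ) where
  open CommutativeRing K

  ι : ℕ → Carrier
  ι zero    = 0#
  ι (suc n) = 1# + ι n

  IsField : Set (c ⊔ ℓ)
  IsField = (¬ (1# ≈ 0#)) × (∀ x → ¬ (x ≈ 0#) → Σ Carrier (λ y → x * y ≈ 1#))

  CharZero : Set ℓ
  CharZero = ∀ n → ¬ (n ≡ 0) → ¬ (ι n ≈ 0#)

  δ : Word → Word → Carrier
  δ u v = if u ≟w v then 1# else 0#

  sumK : List Carrier → Carrier
  sumK []       = 0#
  sumK (x ∷ xs) = x + sumK xs

  ε : Word → Carrier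
  ε []      = 1#
  ε (_ ∷ _) = 0#

  coefΔ : Word → Word → Word → Carrier
  coefΔ a b c = sumK (map (λ { (x , y) → δ x b * δ y c }) (Δ a))

  -- coefficient of M_b ⊗ M_c ⊗ M_e in (Δ ⊗ id) Δ (M_a)
  coefΔid : Word → Word → Word → Word → Carrier
  coefΔid a b c e = sumK (map (λ { (x , y) → coefΔ x b c * δ y e }) (Δ a))

  -- coefficient of M_b ⊗ M_c ⊗ M_e in (id ⊗ Δ) Δ (M_a)
  coefidΔ : Word → Word → Word → Word → Carrier
  coefidΔ a b c e = sumK (map (λ { (x , y) → δ x b * coefΔ y c e }) (Δ a))

  -- coefficient of M_b in (ε ⊗ id) Δ (M_a)
  coefεid : Word → Word → Carrier
  coefεid a b = sumK (map (λ { (x , y) → ε x * δ y b }) (Δ a))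

  -- coefficient of M_b in (id ⊗ ε) Δ (M_a)
  coefidε : Word → Word → Carrier
  coefidε a b = sumK (map (λ { (x , y) → δ x b * ε y }) (Δ a))

  -- (K𝒫, Δ, ε) is a cocommutative coalgebra: Δ maps into K𝒫 ⊗ K𝒫,
  -- coassociativity, counit laws and cocommutativity, checked on the
  -- basis {M_a : a parking function} (which suffices by linearity).
  IsCocommCoalgebra : Set ℓ
  IsCocommCoalgebra =
      (∀ a → IsParking a → All (λ { (x , y) → IsParking x × IsParking y }) (Δ a))
    × (∀ a → IsParking a → ∀ b c e → coefΔid a b c e ≈ coefidΔ a b c e)
    × (∀ a → IsParking a → ∀ b → coefεid a b ≈ δ a b)
    × (∀ a → IsParking a → ∀ b → coefidε a b ≈ δ a b)
    × (∀ a → IsParking a → ∀ b c → coefΔ a b c ≈ coefΔ a c b)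

module Submission where

-- By definition Δ(M_a) is the sum, over the splittings (S , F_a ∖ S) of the
-- LR-decomposition F_a, of M_{parkSub S} ⊗ M_{parkSub (F_a ∖ S)}, where
-- parkSub S is the parkization of the subword of a formed by the blocks S.
-- Cocommutativity and the counit laws are reindexings of this sum (exchange
-- the two sides; only S = ∅ survives ε).  Coassociativity rests on one
-- combinatorial fact, Δ-parkSub: Δ(M_{parkSub S}) is again the sum over the
-- splittings of S itself.  It combines two developments:
--   * Parkization: Park u relabels the letters of u by a map that is
--     increasing on them and compatible with the parkization of subwords
--     (relabelling); its core is that lowering a word at a "sparse" absent
--     letter does not change its parkization (Park-lower-sparse).
--   * LRDecomposition: the LR-decomposition of the concatenation of an
--     LR-family is the family, and LR-families are stable under subfamilies
--     and increasing relabellings; hence F(parkSub S) is S relabelled.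

open import Defs
open import Algebra.Bundles using (CommutativeRing)
open import Data.Product using (_,_)

module Parkization where
  open import Data.Nat
  open import Data.Nat.Properties
    using ( ≤-refl; ≤-reflexive; ≤-trans; ≤-antisym; ≤-pred; <-trans; <-≤-trans; <-cmp
          ; <⇒≤; <⇒≱; ≤⇒≯; ≮⇒≥; ≰⇒>; ≤∧≢⇒<; 1+n≰n; n≤1+n; m≤n⇒m≤1+n; m≤n⇒m<n∨m≡n; m≤m+n
          ; +-comm; +-suc; +-identityʳ; +-cancelˡ-≤; +-mono-≤; +-mono-<-≤; +-monoʳ-<; +-monoʳ-≤; +-monoˡ-≤
          ; ≤ᵇ-reflects-≤; <ᵇ-reflects-<; ≡ᵇ⇒≡; ≡⇒≡ᵇ; ≤-decTotalOrder; module ≤-Reasoning)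
  open import Data.Bool using (Bool; true; false; if_then_else_; T)
  open import Data.Bool.Properties using (T-≡)
  open import Data.Unit using (tt)
  open import Data.Sum using (_⊎_; inj₁; inj₂)
  open import Data.Product using (_×_; _,_; proj₁)
  open import Data.List using (List; []; _∷_; length; map)
  open import Data.List.Properties using (length-map; map-∘; map-cong; map-id)
  open import Data.Nat.ListAction using (sum)
  open import Data.List.Relation.Unary.All using (All; []; _∷_)
  import Data.List.Relation.Unary.All as All
  open import Data.List.Relation.Unary.Linked using (Linked)
  import Data.List.Relation.Unary.Linked as Linked
  open import Data.List.Relation.Unary.Linked.Properties using (Linked⇒All)
  open import Data.List.Relation.Binary.Permutation.Propositional
    using (_↭_) renaming (refl to ↭-refl; prep to ↭-prep; swap to ↭-swap; trans to ↭-trans)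
  open import Data.List.Relation.Binary.Permutation.Propositional.Properties using (↭-length)
  open import Data.List.Sort.InsertionSort ≤-decTotalOrder using (sort)
  open import Data.List.Sort.InsertionSort.Properties ≤-decTotalOrder using (sort-↭; sort-↗)
  open import Data.List.Relation.Binary.Sublist.Propositional using (_⊆_; []; _∷_; _∷ʳ_)
  open import Data.List.Relation.Binary.Sublist.Propositional.Properties using (map⁺; All-resp-⊆)
  open import Data.List.Membership.Propositional using (_∈_)
  open import Data.List.Membership.Propositional.Properties using (∈-map⁺)
  open import Function.Bundles using (Equivalence)
  open import Relation.Nullary using (yes; no; contradiction)
  open import Relation.Nullary.Reflects using (ofʸ; ofⁿ)
  open import Relation.Binary.Definitions using (tri<; tri≈; tri>)
  open import Relation.Binary.PropositionalEquality
    using (_≡_; _≢_; refl; sym; trans; cong; cong₂; subst; subst₂; module ≡-Reasoning)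

  ≤ᵇ-true : ∀ {m n} → m ≤ n → (m ≤ᵇ n) ≡ true
  ≤ᵇ-true {m} {n} m≤n with m ≤ᵇ n | ≤ᵇ-reflects-≤ m n
  ... | true  | _      = refl
  ... | false | ofⁿ m≰n = contradiction m≤n m≰n

  ≤ᵇ-false : ∀ {m n} → n < m → (m ≤ᵇ n) ≡ false
  ≤ᵇ-false {m} {n} n<m with m ≤ᵇ n | ≤ᵇ-reflects-≤ m n
  ... | false | _       = refl
  ... | true  | ofʸ m≤n = contradiction m≤n (<⇒≱ n<m)

  <ᵇ-true : ∀ {m n} → m < n → (m <ᵇ n) ≡ true
  <ᵇ-true {m} {n} m<n with m <ᵇ n | <ᵇ-reflects-< m n
  ... | true  | _       = refl
  ... | false | ofⁿ m≮n = contradiction m<n m≮n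

  <ᵇ-false : ∀ {m n} → n ≤ m → (m <ᵇ n) ≡ false
  <ᵇ-false {m} {n} n≤m with m <ᵇ n | <ᵇ-reflects-< m n
  ... | false | _       = refl
  ... | true  | ofʸ m<n = contradiction n≤m (<⇒≱ m<n)

  -- The step of _≤ᵇ_ on successors (by cases, since _<ᵇ_ is a builtin).
  ≤ᵇ-suc : ∀ m n → (suc m ≤ᵇ suc n) ≡ (m ≤ᵇ n)
  ≤ᵇ-suc zero    n = refl
  ≤ᵇ-suc (suc m) n = refl

  <ᵇ-true⁻ : ∀ {m n} → (m <ᵇ n) ≡ true → m < n
  <ᵇ-true⁻ {m} {n} eq with m <ᵇ n | <ᵇ-reflects-< m n
  <ᵇ-true⁻ {m} {n} () | false | _
  ... | true | ofʸ m<n = m<n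

  <ᵇ-false⁻ : ∀ {m n} → (m <ᵇ n) ≡ false → n ≤ m
  <ᵇ-false⁻ {m} {n} eq with m <ᵇ n | <ᵇ-reflects-< m n
  <ᵇ-false⁻ {m} {n} () | true | _
  ... | false | ofⁿ m≮n = ≮⇒≥ m≮n

  countLe-here : ∀ {t x} w → x ≤ t → countLe t (x ∷ w) ≡ suc (countLe t w)
  countLe-here w x≤t rewrite ≤ᵇ-true x≤t = refl

  countLe-skip : ∀ {t x} w → t < x → countLe t (x ∷ w) ≡ countLe t w
  countLe-skip w t<x rewrite ≤ᵇ-false t<x = refl

  countLe-≤-length : ∀ t w → countLe t w ≤ length w
  countLe-≤-length t []      = z≤n
  countLe-≤-length t (x ∷ w) with x ≤? t
  ... | yes x≤t rewrite countLe-here w x≤t = s≤s (countLe-≤-length t w)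
  ... | no  x≰t rewrite countLe-skip w (≰⇒> x≰t) = m≤n⇒m≤1+n (countLe-≤-length t w)

  countLe-mono : ∀ {s t} w → s ≤ t → countLe s w ≤ countLe t w
  countLe-mono []      s≤t = z≤n
  countLe-mono {s} {t} (x ∷ w) s≤t with x ≤? s | x ≤? t
  ... | yes x≤s | _       rewrite countLe-here w x≤s | countLe-here w (≤-trans x≤s s≤t) =
    s≤s (countLe-mono w s≤t)
  ... | no  x≰s | yes x≤t rewrite countLe-skip w (≰⇒> x≰s) | countLe-here w x≤t =
    m≤n⇒m≤1+n (countLe-mono w s≤t)
  ... | no  x≰s | no  x≰t rewrite countLe-skip w (≰⇒> x≰s) | countLe-skip w (≰⇒> x≰t) =
    countLe-mono w s≤t

  countLe-full : ∀ t w → length w ≤ countLe t w → All (_≤ t) w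
  countLe-full t []      _ = []
  countLe-full t (x ∷ w) full with x ≤? t
  ... | yes x≤t rewrite countLe-here w x≤t = x≤t ∷ countLe-full t w (≤-pred full)
  ... | no  x≰t rewrite countLe-skip w (≰⇒> x≰t) =
    contradiction (countLe-≤-length t w) (<⇒≱ full)

  countLe-none : ∀ t w → All (t <_) w → countLe t w ≡ 0
  countLe-none t []      []           = refl
  countLe-none t (x ∷ w) (t<x ∷ t<w) rewrite countLe-skip w t<x = countLe-none t w t<w

  countLe-flat : ∀ f w → countLe (suc f) w ≤ countLe f w → All (_≢ suc f) w
  countLe-flat f []      _    = []
  countLe-flat f (x ∷ w) flat with x ≤? f | x ≤? suc f
  ... | yes x≤f | _ rewrite countLe-here w x≤f | countLe-here w (m≤n⇒m≤1+n x≤f) =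
    (λ x≡1+f → 1+n≰n (subst (_≤ f) x≡1+f x≤f)) ∷ countLe-flat f w (≤-pred flat)
  ... | no x≰f | yes x≤1+f rewrite countLe-skip w (≰⇒> x≰f) | countLe-here w x≤1+f =
    contradiction (countLe-mono w (n≤1+n f)) (<⇒≱ flat)
  ... | no x≰f | no x≰1+f rewrite countLe-skip w (≰⇒> x≰f) | countLe-skip w (≰⇒> x≰1+f) =
    (λ x≡1+f → x≰1+f (≤-reflexive x≡1+f)) ∷ countLe-flat f w flat

  countLe-map : ∀ (f : ℕ → ℕ) t s w → (∀ x → (f x ≤ᵇ t) ≡ (x ≤ᵇ s)) →
                countLe t (map f w) ≡ countLe s w
  countLe-map f t s []      _    = refl
  countLe-map f t s (x ∷ w) same rewrite same x with x ≤ᵇ s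
  ... | true  = cong suc (countLe-map f t s w same)
  ... | false = countLe-map f t s w same

  -- The bounded search dSearch k i w scans t = i, i+1, …, i+k-1 for the first
  -- t with countLe t w < t (returning i+k if there is none).
  module _ (w : Word) where

    dSearch-≥ : ∀ k i → i ≤ dSearch k i w
    dSearch-≥ zero    i = ≤-refl
    dSearch-≥ (suc k) i with countLe i w <ᵇ i
    ... | true  = ≤-refl
    ... | false = ≤-trans (n≤1+n i) (dSearch-≥ k (suc i))

    dSearch-≤ : ∀ k i → dSearch k i w ≤ i + k
    dSearch-≤ zero    i = ≤-reflexive (sym (+-identityʳ i))
    dSearch-≤ (suc k) i with countLe i w <ᵇ i
    ... | true  = m≤m+n i (suc k)
    ... | false = ≤-trans (dSearch-≤ k (suc i)) (≤-reflexive (sym (+-suc i k)))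

    dSearch-below : ∀ k i t → i ≤ t → t < dSearch k i w → t ≤ countLe t w
    dSearch-below zero    i t i≤t t<d = contradiction i≤t (<⇒≱ t<d)
    dSearch-below (suc k) i t i≤t t<d with countLe i w <ᵇ i in found
    ... | true  = contradiction i≤t (<⇒≱ t<d)
    ... | false with m≤n⇒m<n∨m≡n i≤t
    ...   | inj₁ i<t  = dSearch-below k (suc i) t i<t t<d
    ...   | inj₂ refl = <ᵇ-false⁻ found

    dSearch-found : ∀ k i → dSearch k i w < i + k → countLe (dSearch k i w) w < dSearch k i w
    dSearch-found zero    i d<i = contradiction (≤-reflexive (+-identityʳ i)) (<⇒≱ d<i)
    dSearch-found (suc k) i d<i with countLe i w <ᵇ i in found
    ... | true  = <ᵇ-true⁻ found
    ... | false = dSearch-found k (suc i) (≤-trans d<i (≤-reflexive (+-suc i k)))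

  d-≥1 : ∀ w → 1 ≤ d w
  d-≥1 w = dSearch-≥ w (length w) 1

  d-≤ : ∀ w → d w ≤ suc (length w)
  d-≤ w = dSearch-≤ w (length w) 1

  d-below : ∀ w t → t < d w → t ≤ countLe t w
  d-below w zero    _   = z≤n
  d-below w (suc t) t<d = dSearch-below w (length w) 1 (suc t) (s≤s z≤n) t<d

  d-found : ∀ w → d w ≤ length w → countLe (d w) w < d w
  d-found w d≤n = dSearch-found w (length w) 1 (s≤s d≤n)

  d-unique : ∀ w i → i ≤ length w → (∀ t → t < i → t ≤ countLe t w) → countLe i w < i → d w ≡ i
  d-unique w i i≤n below found with <-cmp (d w) i
  ... | tri≈ _ d≡i _ = d≡i
  ... | tri< d<i _ _ = contradiction (below (d w) d<i) (<⇒≱ (d-found w (≤-trans (<⇒≤ d<i) i≤n)))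
  ... | tri> _ _ i<d = contradiction (d-below w i i<d) (<⇒≱ found)

  d-parking : ∀ w → (∀ t → t ≤ length w → t ≤ countLe t w) → d w ≡ suc (length w)
  d-parking w enough with m≤n⇒m<n∨m≡n (d-≤ w)
  ... | inj₂ d≡1+n      = d≡1+n
  ... | inj₁ (s≤s d≤n) = contradiction (enough (d w) d≤n) (<⇒≱ (d-found w d≤n))

  d-absent : ∀ w → d w ≤ length w → All (_≢ d w) w
  d-absent w d≤n with d w | d-≥1 w | d-found w d≤n | d-below w
  ... | suc f | _ | found | below = countLe-flat f w (≤-trans (≤-pred found) (below f ≤-refl))

  low : ℕ → ℕ → ℕ
  low e x = if e <ᵇ x then x ∸ 1 else x

  low-≤ : ∀ {e x} → x ≤ e → low e x ≡ x
  low-≤ x≤e rewrite <ᵇ-false x≤e = refl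

  low-> : ∀ {e x} → e < x → suc (low e x) ≡ x
  low-> {e} {suc x} e<x rewrite <ᵇ-true e<x = refl

  low-cases : ∀ e x → (x ≤ e × low e x ≡ x) ⊎ (e < x × suc (low e x) ≡ x)
  low-cases e x with x ≤? e
  ... | yes x≤e = inj₁ (x≤e , low-≤ x≤e)
  ... | no  x≰e = inj₂ (≰⇒> x≰e , low-> (≰⇒> x≰e))

  low-decreasing : ∀ e x → low e x ≤ x
  low-decreasing e x with low-cases e x
  ... | inj₁ (_ , low≡x)   = ≤-reflexive low≡x
  ... | inj₂ (_ , 1+low≡x) = ≤-trans (n≤1+n _) (≤-reflexive 1+low≡x)

  length-lower : ∀ e w → length (lower e w) ≡ length w
  length-lower e w = length-map (low e) w

  sum-lower-≤ : ∀ e w → sum (lower e w) ≤ sum w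
  sum-lower-≤ e []      = z≤n
  sum-lower-≤ e (x ∷ w) = +-mono-≤ (low-decreasing e x) (sum-lower-≤ e w)

  sum-lower-< : ∀ e w → countLe e w < length w → sum (lower e w) < sum w
  sum-lower-< e (x ∷ w) some with low-cases e x
  ... | inj₁ (x≤e , low≡x) rewrite countLe-here w x≤e | low≡x =
    +-monoʳ-< x (sum-lower-< e w (≤-pred some))
  ... | inj₂ (_ , 1+low≡x) =
    +-mono-<-≤ (≤-reflexive 1+low≡x) (sum-lower-≤ e w)

  countLe-lower-below : ∀ e t w → t < e → countLe t (lower e w) ≡ countLe t w
  countLe-lower-below e t w t<e = countLe-map (low e) t t w same
    where
    same : ∀ x → (low e x ≤ᵇ t) ≡ (x ≤ᵇ t)
    same x with low-cases e x
    ... | inj₁ (_ , low≡x) rewrite low≡x = refl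
    ... | inj₂ (e<x , 1+low≡x)
      rewrite ≤ᵇ-false (<-≤-trans t<e (≤-pred (≤-trans e<x (≤-reflexive (sym 1+low≡x)))))
            | ≤ᵇ-false (<-trans t<e e<x) = refl

  countLe-lower-above : ∀ e t w → e ≤ t → countLe t (lower e w) ≡ countLe (suc t) w
  countLe-lower-above e t w e≤t = countLe-map (low e) t (suc t) w same
    where
    same : ∀ x → (low e x ≤ᵇ t) ≡ (x ≤ᵇ suc t)
    same x with low-cases e x
    ... | inj₁ (x≤e , low≡x) rewrite low≡x | ≤ᵇ-true (≤-trans x≤e e≤t)
                                           | ≤ᵇ-true (m≤n⇒m≤1+n (≤-trans x≤e e≤t)) = refl
    ... | inj₂ (_ , 1+low≡x) = trans (sym (≤ᵇ-suc (low e x) t)) (cong (_≤ᵇ suc t) 1+low≡x)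

  low-suc : ∀ {e y} → e < suc y → low e (suc y) ≡ y
  low-suc e<1+y rewrite <ᵇ-true e<1+y = refl

  low-comm : ∀ {e f} x → e ≤ f → low e (low (suc f) x) ≡ low f (low e x)
  low-comm {e} {f} x e≤f with x ≤? e
  ... | yes x≤e rewrite low-≤ {suc f} (≤-trans x≤e (m≤n⇒m≤1+n e≤f)) | low-≤ x≤e
                      | low-≤ (≤-trans x≤e e≤f) = refl
  low-comm zero e≤f | no x≰e = contradiction z≤n x≰e
  low-comm {e} {f} (suc y) e≤f | no x≰e with suc y ≤? suc f
  ... | yes y<1+f rewrite low-≤ y<1+f | low-suc (≰⇒> x≰e) | low-≤ (≤-pred y<1+f) = refl
  low-comm (suc zero) e≤f | no _ | no y≮1+f = contradiction (s≤s z≤n) y≮1+f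
  low-comm {e} {f} (suc (suc z)) e≤f | no x≰e | no y≮1+f
    rewrite low-suc (≰⇒> y≮1+f) | low-suc (≰⇒> x≰e)
          | low-suc (≤-trans (s≤s e≤f) (≤-pred (≰⇒> y≮1+f)))
          | low-suc (≤-pred (≰⇒> y≮1+f)) = refl

  lower-comm : ∀ {e f} w → e ≤ f → lower e (lower (suc f) w) ≡ lower f (lower e w)
  lower-comm w e≤f = trans (sym (map-∘ w)) (trans (map-cong (λ x → low-comm x e≤f) w) (map-∘ w))

  lower-id : ∀ e w → All (_≤ e) w → lower e w ≡ w
  lower-id e []      []           = refl
  lower-id e (x ∷ w) (x≤e ∷ w≤e) = cong₂ _∷_ (low-≤ x≤e) (lower-id e w w≤e)

  absent-lower : ∀ {e f} w → e ≤ f → All (_≢ suc f) w → All (_≢ e) w → All (_≢ f) (lower e w)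
  absent-lower []      e≤f []           []          = []
  absent-lower {e} {f} (x ∷ w) e≤f (x≢1+f ∷ w≢1+f) (x≢e ∷ w≢e) =
    low≢f ∷ absent-lower w e≤f w≢1+f w≢e
    where
    low≢f : low e x ≢ f
    low≢f low≡f with low-cases e x
    ... | inj₁ (x≤e , low≡x) = x≢e (≤-antisym x≤e (subst (e ≤_) (trans (sym low≡f) low≡x) e≤f))
    ... | inj₂ (_ , 1+low≡x) = x≢1+f (trans (sym 1+low≡x) (cong suc low≡f))

  Pos : Word → Set
  Pos w = All (1 ≤_) w

  Pos-lower : ∀ {e} w → 1 ≤ e → Pos w → Pos (lower e w)
  Pos-lower []      _   []           = []
  Pos-lower {e} (x ∷ w) 1≤e (1≤x ∷ pos) = 1≤low ∷ Pos-lower w 1≤e pos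
    where
    1≤low : 1 ≤ low e x
    1≤low with low-cases e x
    ... | inj₁ (_ , low≡x)   = subst (1 ≤_) (sym low≡x) 1≤x
    ... | inj₂ (e<x , 1+low≡x) = ≤-pred (≤-trans (s≤s 1≤e) (≤-trans e<x (≤-reflexive (sym 1+low≡x))))

  low-mono : ∀ e {x y} → x ≢ e → y ≢ e → x < y → low e x < low e y
  low-mono e {x} {y} x≢e y≢e x<y with low-cases e x | low-cases e y
  ... | inj₁ (_ , lx≡x) | inj₁ (_ , ly≡y) = subst₂ _<_ (sym lx≡x) (sym ly≡y) x<y
  ... | inj₁ (x≤e , lx≡x) | inj₂ (e<y , 1+ly≡y) =
    subst (_< low e y) (sym lx≡x) (<-≤-trans (≤∧≢⇒< x≤e x≢e) (≤-pred (≤-trans e<y (≤-reflexive (sym 1+ly≡y)))))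
  ... | inj₂ (e<x , _) | inj₁ (y≤e , _) = contradiction (<-trans e<x x<y) (≤⇒≯ y≤e)
  ... | inj₂ (_ , 1+lx≡x) | inj₂ (_ , 1+ly≡y) = ≤-pred (subst₂ _<_ (sym 1+lx≡x) (sym 1+ly≡y) x<y)

  parked? : Word → Bool
  parked? w = d w ≡ᵇ suc (length w)

  parked-true : ∀ w → parked? w ≡ true → d w ≡ suc (length w)
  parked-true w eq = ≡ᵇ⇒≡ (d w) (suc (length w)) (subst T (sym eq) tt)

  parked-false : ∀ w → parked? w ≡ false → d w ≤ length w
  parked-false w eq with m≤n⇒m<n∨m≡n (d-≤ w)
  ... | inj₁ (s≤s d≤n) = d≤n
  ... | inj₂ d≡1+n      = contradiction (subst T eq (≡⇒≡ᵇ (d w) (suc (length w)) d≡1+n)) (λ ())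

  parked-false⁻ : ∀ w → d w ≤ length w → parked? w ≡ false
  parked-false⁻ w d≤n with parked? w in eq
  ... | false = refl
  ... | true  = contradiction d≤n (subst (_≰ length w) (sym (parked-true w eq)) 1+n≰n)

  sum-step : ∀ w → parked? w ≡ false → sum (lower (d w) w) < sum w
  sum-step w eq = sum-lower-< (d w) w (<-≤-trans (d-found w d≤n) d≤n)
    where d≤n = parked-false w eq

  parkFuel-stable : ∀ k k′ w → sum w < k → sum w < k′ → parkFuel k w ≡ parkFuel k′ w
  parkFuel-stable (suc k) (suc k′) w s<k s<k′ with parked? w in eq
  ... | true  = refl
  ... | false = parkFuel-stable k k′ (lower (d w) w)
                  (<-≤-trans (sum-step w eq) (≤-pred s<k)) (<-≤-trans (sum-step w eq) (≤-pred s<k′))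

  Park-parked : ∀ w → parked? w ≡ true → Park w ≡ w
  Park-parked w eq rewrite eq = refl

  Park-step : ∀ w → parked? w ≡ false → Park w ≡ Park (lower (d w) w)
  Park-step w eq rewrite eq =
    parkFuel-stable (sum w) (suc (sum (lower (d w) w))) (lower (d w) w) (sum-step w eq) ≤-refl

  Park-ind : (P : Word → Set) →
             (∀ w → parked? w ≡ true → P w) →
             (∀ w → parked? w ≡ false → P (lower (d w) w) → P w) →
             ∀ w → P w
  Park-ind P base step w = go (suc (sum w)) w ≤-refl
    where
    go : ∀ k w → sum w < k → P w
    go (suc k) w s<k with parked? w in eq
    ... | true  = base w eq
    ... | false = step w eq (go k (lower (d w) w) (<-≤-trans (sum-step w eq) (≤-pred s<k)))

  countLe-↭ : ∀ t {xs ys} → xs ↭ ys → countLe t xs ≡ countLe t ys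
  countLe-↭ t ↭-refl          = refl
  countLe-↭ t (↭-prep x p) with x ≤ᵇ t
  ... | true  = cong suc (countLe-↭ t p)
  ... | false = countLe-↭ t p
  countLe-↭ t (↭-swap x y p) with x ≤ᵇ t | y ≤ᵇ t
  ... | true  | true  = cong (λ n → suc (suc n)) (countLe-↭ t p)
  ... | true  | false = cong suc (countLe-↭ t p)
  ... | false | true  = cong suc (countLe-↭ t p)
  ... | false | false = countLe-↭ t p
  countLe-↭ t (↭-trans p q) = trans (countLe-↭ t p) (countLe-↭ t q)

  countLe-sort : ∀ t w → countLe t (sort w) ≡ countLe t w
  countLe-sort t w = countLe-↭ t (sort-↭ w)

  length-sort : ∀ w → length (sort w) ≡ length w
  length-sort w = ↭-length (sort-↭ w)

  bounded⇒count : ∀ i s → bounded i s → ∀ j → j < length s → suc j ≤ countLe (i + j) s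
  bounded⇒count i (b ∷ s) (b≤i , _) zero _
    rewrite countLe-here s (≤-trans b≤i (m≤m+n i 0)) = s≤s z≤n
  bounded⇒count i (b ∷ s) (b≤i , bs) (suc j) (s≤s j<n)
    rewrite countLe-here s (≤-trans b≤i (m≤m+n i (suc j))) | +-suc i j =
    s≤s (bounded⇒count (suc i) s bs j j<n)

  count⇒bounded : ∀ i s → Linked _≤_ s → (∀ j → j < length s → suc j ≤ countLe (i + j) s) → bounded i s
  count⇒bounded i []      _      _      = tt
  count⇒bounded i (b ∷ s) sorted enough = b≤i , count⇒bounded (suc i) s (Linked.tail sorted) enough′
    where
    b≤i : b ≤ i
    b≤i with b ≤? i
    ... | yes b≤i = b≤i
    ... | no  b≰i = contradiction (subst (1 ≤_) none (enough 0 (s≤s z≤n))) (λ ())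
      where
      none : countLe (i + 0) (b ∷ s) ≡ 0
      none rewrite +-identityʳ i =
        countLe-none i (b ∷ s) (All.map (<-≤-trans (≰⇒> b≰i)) (Linked⇒All ≤-trans ≤-refl sorted))
    enough′ : ∀ j → j < length s → suc j ≤ countLe (suc i + j) s
    enough′ j j<n with enough (suc j) (s≤s j<n)
    ... | more rewrite +-suc i j | countLe-here s (≤-trans b≤i (m≤n⇒m≤1+n (m≤m+n i j))) = ≤-pred more

  parked⇒IsParking : ∀ w → parked? w ≡ true → Pos w → IsParking w
  parked⇒IsParking w eq pos =
    All.zip (pos , countLe-full n w (d-below w n n<d)) ,
    count⇒bounded 1 (sort w) (sort-↗ w) enough
    where
    n = length w
    n<d : n < d w
    n<d = subst (n <_) (sym (parked-true w eq)) ≤-refl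
    enough : ∀ j → j < length (sort w) → suc j ≤ countLe (suc j) (sort w)
    enough j j<n rewrite countLe-sort (suc j) w =
      d-below w (suc j) (subst (suc j <_) (sym (parked-true w eq)) (s≤s (subst (j <_) (length-sort w) j<n)))

  IsParking⇒parked : ∀ a → IsParking a → parked? a ≡ true
  IsParking⇒parked a (_ , bnd) =
    Equivalence.to T-≡ (≡⇒≡ᵇ (d a) (suc (length a)) (d-parking a enough))
    where
    enough : ∀ t → t ≤ length a → t ≤ countLe t a
    enough zero    _   = z≤n
    enough (suc j) t≤n = subst (suc j ≤_) (countLe-sort (suc j) a)
      (bounded⇒count 1 (sort a) bnd j (subst (j <_) (sym (length-sort a)) t≤n))

  IsParking⇒Pos : ∀ a → IsParking a → Pos a
  IsParking⇒Pos a (letters , _) = All.map proj₁ letters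

  Park-IsParking : ∀ w → Pos w → IsParking (Park w)
  Park-IsParking = Park-ind (λ w → Pos w → IsParking (Park w)) base step
    where
    base : ∀ w → parked? w ≡ true → Pos w → IsParking (Park w)
    base w eq pos rewrite Park-parked w eq = parked⇒IsParking w eq pos
    step : ∀ w → parked? w ≡ false → (Pos (lower (d w) w) → IsParking (Park (lower (d w) w))) →
           Pos w → IsParking (Park w)
    step w eq ih pos rewrite Park-step w eq = ih (Pos-lower w (d-≥1 w) pos)

  Park-id : ∀ a → IsParking a → Park a ≡ a
  Park-id a pf = Park-parked a (IsParking⇒parked a pf)

  length-Park : ∀ w → length (Park w) ≡ length w
  length-Park = Park-ind (λ w → length (Park w) ≡ length w) base step
    where
    base : ∀ w → parked? w ≡ true → length (Park w) ≡ length w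
    base w eq = cong length (Park-parked w eq)
    step : ∀ w → parked? w ≡ false → length (Park (lower (d w) w)) ≡ length (lower (d w) w) →
           length (Park w) ≡ length w
    step w eq ih = trans (cong length (Park-step w eq)) (trans ih (length-lower (d w) w))

  -- A letter e is sparse in v when, for every t < e, fewer than e − t
  -- letters of v lie in the interval (t, e].  Lowering v at a sparse
  -- absent letter does not change its parkization (Park-lower-sparse).
  Sparse : Word → ℕ → Set
  Sparse v e = ∀ t → t < e → suc (t + countLe e v) ≤ e + countLe t v

  sparse-found : ∀ v e → Pos v → 0 < e → Sparse v e → countLe e v < e
  sparse-found v e pos 0<e sparse =
    subst (suc (countLe e v) ≤_) (trans (cong (e +_) (countLe-none 0 v pos)) (+-identityʳ e)) (sparse 0 0<e)

  sparse-d≤ : ∀ v e → Pos v → 0 < e → Sparse v e → d v ≤ e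
  sparse-d≤ v e pos 0<e sparse with d v ≤? e
  ... | yes d≤e = d≤e
  ... | no  d≰e = contradiction (d-below v e (≰⇒> d≰e)) (<⇒≱ (sparse-found v e pos 0<e sparse))

  d-lower : ∀ e v → d v ≤ length v → d v < e → d (lower e v) ≡ d v
  d-lower e v d≤n d<e =
    d-unique (lower e v) (d v) (subst (d v ≤_) (sym (length-lower e v)) d≤n)
      (λ t t<d → subst (t ≤_) (sym (countLe-lower-below e t v (<-trans t<d d<e))) (d-below v t t<d))
      (subst (_< d v) (sym (countLe-lower-below e (d v) v d<e)) (d-found v d≤n))

  sparse-lower : ∀ v f → d v ≤ length v → d v ≤ f → Sparse v (suc f) → Sparse (lower (d v) v) f
  sparse-lower v f d≤n d≤f sparse t t<f
    rewrite countLe-lower-above (d v) f v d≤f with d v ≤? t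
  ... | yes d≤t rewrite countLe-lower-above (d v) t v d≤t = ≤-pred (sparse (suc t) (s≤s t<f))
  ... | no  d≰t rewrite countLe-lower-below (d v) t v (≰⇒> d≰t) = begin
    suc (t + countLe (suc f) v) ≡⟨ sym (+-suc t _) ⟩
    t + suc (countLe (suc f) v) ≤⟨ +-mono-≤ (d-below v t (≰⇒> d≰t)) gap ⟩
    countLe t v + f             ≡⟨ +-comm (countLe t v) f ⟩
    f + countLe t v             ∎
    where
    open ≤-Reasoning
    dv = d v
    gap : suc (countLe (suc f) v) ≤ f
    gap = +-cancelˡ-≤ dv _ _ (begin
      dv + suc (countLe (suc f) v) ≡⟨ +-suc dv _ ⟩
      suc (dv + countLe (suc f) v) ≤⟨ sparse dv (s≤s d≤f) ⟩
      suc f + countLe dv v         ≡⟨ sym (+-suc f _) ⟩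
      f + suc (countLe dv v)       ≤⟨ +-monoʳ-≤ f (d-found v d≤n) ⟩
      f + dv                       ≡⟨ +-comm f dv ⟩
      dv + f                       ∎)

  Park-lower-sparse : ∀ v → Pos v → ∀ e → 0 < e → All (_≢ e) v → Sparse v e →
                      Park (lower e v) ≡ Park v
  Park-lower-sparse = Park-ind Invariant base step
    where
    Invariant : Word → Set
    Invariant v = Pos v → ∀ e → 0 < e → All (_≢ e) v → Sparse v e → Park (lower e v) ≡ Park v

    -- A parked word has all letters ≤ n < d(v) ≤ e, so lowering at e is the identity.
    base : ∀ v → parked? v ≡ true → Invariant v
    base v eq pos e 0<e _ sparse = cong Park (lower-id e v (All.map (λ x≤n → ≤-trans x≤n (<⇒≤ n<e)) letters≤n))
      where
      n = length v
      n<d : n < d v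
      n<d = subst (n <_) (sym (parked-true v eq)) ≤-refl
      letters≤n : All (_≤ n) v
      letters≤n = countLe-full n v (d-below v n n<d)
      n<e : n < e
      n<e = <-≤-trans n<d (sparse-d≤ v e pos 0<e sparse)

    -- Otherwise d(v) ≤ e; if d(v) < e, lowering at e commutes with the
    -- parkization step of v and we conclude by induction.
    step : ∀ v → parked? v ≡ false → Invariant (lower (d v) v) → Invariant v
    step v eq ih pos e 0<e absent sparse with m≤n⇒m<n∨m≡n (sparse-d≤ v e pos 0<e sparse)
    ... | inj₂ d≡e = trans (cong (λ x → Park (lower x v)) (sym d≡e)) (sym (Park-step v eq))
    ... | inj₁ d<e@(s≤s {n = f} d≤f) = begin
      Park (lower e v)                          ≡⟨ Park-step (lower e v) lowered-not-parked ⟩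
      Park (lower (d (lower e v)) (lower e v))  ≡⟨ cong (λ x → Park (lower x (lower e v))) same-d ⟩
      Park (lower (d v) (lower (suc f) v))      ≡⟨ cong Park (lower-comm v d≤f) ⟩
      Park (lower f (lower (d v) v))            ≡⟨ ih (Pos-lower v (d-≥1 v) pos) f (<-≤-trans (d-≥1 v) d≤f)
                                                      (absent-lower v d≤f absent (d-absent v d≤n))
                                                      (sparse-lower v f d≤n d≤f sparse) ⟩
      Park (lower (d v) v)                      ≡⟨ sym (Park-step v eq) ⟩
      Park v                                    ∎
      where
      open ≡-Reasoning
      d≤n = parked-false v eq
      same-d : d (lower e v) ≡ d v
      same-d = d-lower e v d≤n d<e
      lowered-not-parked : parked? (lower e v) ≡ false
      lowered-not-parked = parked-false⁻ (lower e v) (subst₂ _≤_ (sym same-d) (sym (length-lower e v)) d≤n)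

  countLe-sublist : ∀ {v u} → v ⊆ u → ∀ {t s} → t ≤ s →
                    countLe s v + countLe t u ≤ countLe s u + countLe t v
  countLe-sublist [] t≤s = z≤n
  countLe-sublist {v} (_∷ʳ_ {ys = u} x v⊆u) {t} {s} t≤s with x ≤? t | x ≤? s
  ... | yes x≤t | _ rewrite countLe-here u x≤t | countLe-here u (≤-trans x≤t t≤s)
                          | +-suc (countLe s v) (countLe t u) = s≤s (countLe-sublist v⊆u t≤s)
  ... | no x≰t | yes x≤s rewrite countLe-skip u (≰⇒> x≰t) | countLe-here u x≤s =
    m≤n⇒m≤1+n (countLe-sublist v⊆u t≤s)
  ... | no x≰t | no x≰s rewrite countLe-skip u (≰⇒> x≰t) | countLe-skip u (≰⇒> x≰s) =
    countLe-sublist v⊆u t≤s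
  countLe-sublist (_∷_ {x} {v} {_} {u} refl v⊆u) {t} {s} t≤s with x ≤? t | x ≤? s
  ... | yes x≤t | _ rewrite countLe-here u x≤t | countLe-here u (≤-trans x≤t t≤s)
                          | countLe-here v x≤t | countLe-here v (≤-trans x≤t t≤s)
                          | +-suc (countLe s v) (countLe t u) | +-suc (countLe s u) (countLe t v) =
    s≤s (s≤s (countLe-sublist v⊆u t≤s))
  ... | no x≰t | yes x≤s rewrite countLe-skip u (≰⇒> x≰t) | countLe-here u x≤s
                               | countLe-skip v (≰⇒> x≰t) | countLe-here v x≤s =
    s≤s (countLe-sublist v⊆u t≤s)
  ... | no x≰t | no x≰s rewrite countLe-skip u (≰⇒> x≰t) | countLe-skip u (≰⇒> x≰s)
                              | countLe-skip v (≰⇒> x≰t) | countLe-skip v (≰⇒> x≰s) =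
    countLe-sublist v⊆u t≤s

  sparse-sublist : ∀ {v u} → v ⊆ u → d u ≤ length u → Sparse v (d u)
  sparse-sublist {v} {u} v⊆u d≤n t t<d = begin
    suc (t + countLe (d u) v)            ≡⟨ cong suc (+-comm t _) ⟩
    suc (countLe (d u) v + t)            ≤⟨ s≤s (+-monoʳ-≤ _ (d-below u t t<d)) ⟩
    suc (countLe (d u) v + countLe t u)  ≤⟨ s≤s (countLe-sublist v⊆u (<⇒≤ t<d)) ⟩
    suc (countLe (d u) u) + countLe t v  ≤⟨ +-monoˡ-≤ _ (d-found u d≤n) ⟩
    d u + countLe t v                    ∎
    where open ≤-Reasoning

  IncreasingOn : (ℕ → ℕ) → Word → Set
  IncreasingOn g W = ∀ {x y} → x ∈ W → y ∈ W → x < y → g x < g y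

  record Relabelling (u : Word) : Set where
    field
      g             : ℕ → ℕ
      Park≡map      : Park u ≡ map g u
      increasing    : IncreasingOn g u
      park-subwords : ∀ {v} → v ⊆ u → Park (map g v) ≡ Park v

  relabelling : ∀ u → Pos u → Relabelling u
  relabelling = Park-ind (λ u → Pos u → Relabelling u) base step
    where
    base : ∀ u → parked? u ≡ true → Pos u → Relabelling u
    base u eq _ = record
      { g             = λ x → x
      ; Park≡map      = trans (Park-parked u eq) (sym (map-id u))
      ; increasing    = λ _ _ x<y → x<y
      ; park-subwords = λ {v} _ → cong Park (map-id v)
      }

    -- One parkization step relabels by low (d u); compose with the
    -- relabelling of the lowered word.
    step : ∀ u → parked? u ≡ false → (Pos (lower (d u) u) → Relabelling (lower (d u) u)) →
           Pos u → Relabelling u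
    step u eq ih pos = record
      { g             = λ x → R.g (low du x)
      ; Park≡map      = trans (Park-step u eq) (trans R.Park≡map (sym (map-∘ u)))
      ; increasing    = λ x∈u y∈u x<y →
          R.increasing (∈-map⁺ (low du) x∈u) (∈-map⁺ (low du) y∈u)
            (low-mono du (All.lookup absent x∈u) (All.lookup absent y∈u) x<y)
      ; park-subwords = λ {v} v⊆u → begin
          Park (map (λ x → R.g (low du x)) v) ≡⟨ cong Park (map-∘ v) ⟩
          Park (map R.g (lower du v))         ≡⟨ R.park-subwords (map⁺ (low du) v⊆u) ⟩
          Park (lower du v)                   ≡⟨ Park-lower-sparse v (All-resp-⊆ v⊆u pos) du (d-≥1 u)
                                                   (All-resp-⊆ v⊆u absent) (sparse-sublist v⊆u d≤n) ⟩
          Park v                              ∎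
      }
      where
      open ≡-Reasoning
      du = d u
      d≤n = parked-false u eq
      absent = d-absent u d≤n
      module R = Relabelling (ih (Pos-lower u (d-≥1 u) pos))

module LRDecomposition where
  open Parkization
  open import Data.Nat using (ℕ; _≤_; _<_; z≤n; s≤s)
  open import Data.Nat.Properties
    using (≤-refl; ≤-trans; <-≤-trans; <⇒≤; ≮⇒≥; m≤n⇒m<n∨m≡n; _<?_; module ≤-Reasoning)
  open import Data.Unit using (⊤; tt)
  open import Data.Empty using (⊥)
  open import Data.Sum using (inj₁; inj₂)
  open import Data.Product using (_×_; _,_; proj₁)
  open import Data.List using (List; []; _∷_; length; map; _++_; concat; reverse; _ʳ++_)
  open import Data.List.Properties
    using ( map-∘; unfold-reverse; ++-assoc; ʳ++-defn; reverse-++; reverse-involutive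
          ; reverse-map; concat-map; map-++; map-cong-local; ++-identityʳ)
  open import Data.List.Relation.Unary.All using (All; []; _∷_)
  import Data.List.Relation.Unary.All as All
  import Data.List.Relation.Unary.All.Properties as AllP
  open import Data.List.Relation.Unary.Any using (here; there)
  import Data.List.Relation.Unary.Any.Properties as AnyP
  open import Data.List.Membership.Propositional using (_∈_)
  open import Data.List.Membership.Propositional.Properties using (∈-++⁺ˡ; ∈-++⁺ʳ)
  open import Data.List.Relation.Binary.Sublist.Propositional using (_⊆_; []; _∷_; _∷ʳ_; ⊆-refl; minimum)
  open import Data.List.Relation.Binary.Sublist.Propositional.Properties
    using (All-resp-⊆; reverse⁺; concat⁺; length-mono-≤)
  import Data.List.Relation.Binary.Sublist.Heterogeneous as Hetero
  open import Function using (_∘_)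
  open import Relation.Nullary using (yes; no)
  open import Relation.Binary.PropositionalEquality
    using (_≡_; refl; sym; trans; cong; cong₂; subst; module ≡-Reasoning)

  -- The LR-decomposition.  lrBlocks w lists the blocks w_s, …, w_1 of w
  -- from left to right; it concatenates back to w, and it forms an
  -- LR-family: nonempty blocks, each starting with its minimal letter,
  -- whose first letters strictly decrease from left to right.

  first : Word → ℕ
  first []      = 0
  first (x ∷ _) = x

  LRFamily : List Word → Set
  LRFamily []            = ⊤
  LRFamily ([] ∷ _)      = ⊥
  LRFamily ((h ∷ t) ∷ m) = All (h ≤_) t × All (λ B → first B < h) m × LRFamily m

  LRFamily-tail : ∀ {B m} → LRFamily (B ∷ m) → LRFamily m
  LRFamily-tail {h ∷ t} (_ , _ , fam) = fam

  LRFamily-nonempty : ∀ m → LRFamily m → All (λ B → 1 ≤ length B) m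
  LRFamily-nonempty []            _             = []
  LRFamily-nonempty ((h ∷ t) ∷ m) (_ , _ , fam) = s≤s z≤n ∷ LRFamily-nonempty m fam

  lrGo-concat : ∀ m acc rest → concat (lrGo m acc rest) ≡ reverse acc ++ rest
  lrGo-concat m acc []       = refl
  lrGo-concat m acc (y ∷ ys) with y <? m
  ... | yes y<m rewrite <ᵇ-true y<m = cong (reverse acc ++_) (lrGo-concat y (y ∷ []) ys)
  ... | no  y≮m rewrite <ᵇ-false (≮⇒≥ y≮m) = begin
    concat (lrGo m (y ∷ acc) ys)  ≡⟨ lrGo-concat m (y ∷ acc) ys ⟩
    reverse (y ∷ acc) ++ ys       ≡⟨ cong (_++ ys) (unfold-reverse y acc) ⟩
    (reverse acc ++ y ∷ []) ++ ys ≡⟨ ++-assoc (reverse acc) (y ∷ []) ys ⟩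
    reverse acc ++ y ∷ ys         ∎
    where open ≡-Reasoning

  lrBlocks-concat : ∀ w → concat (lrBlocks w) ≡ w
  lrBlocks-concat []      = refl
  lrBlocks-concat (x ∷ w) = lrGo-concat x (x ∷ []) w

  -- While scanning, the current block is m ∷ t with m ≤ t, and every
  -- block emitted later starts with a letter ≤ m.
  lrGo-family : ∀ m acc rest t → reverse acc ≡ m ∷ t → All (m ≤_) t →
                LRFamily (lrGo m acc rest) × All (λ B → first B ≤ m) (lrGo m acc rest)
  lrGo-family m acc [] t rev m≤t rewrite rev = (m≤t , [] , tt) , ≤-refl ∷ []
  lrGo-family m acc (y ∷ ys) t rev m≤t with y <? m
  ... | yes y<m rewrite <ᵇ-true y<m | rev =
    let (fam , heads≤y) = lrGo-family y (y ∷ []) ys [] refl [] in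
    (m≤t , All.map (λ h≤y → <-≤-trans (s≤s h≤y) y<m) heads≤y , fam) ,
    ≤-refl ∷ All.map (λ h≤y → ≤-trans h≤y (<⇒≤ y<m)) heads≤y
  ... | no  y≮m rewrite <ᵇ-false (≮⇒≥ y≮m) =
    lrGo-family m (y ∷ acc) ys (t ++ y ∷ [])
      (trans (unfold-reverse y acc) (cong (_++ y ∷ []) rev)) (AllP.++⁺ m≤t (≮⇒≥ y≮m ∷ []))

  lrBlocks-family : ∀ w → LRFamily (lrBlocks w)
  lrBlocks-family []      = tt
  lrBlocks-family (x ∷ w) = proj₁ (lrGo-family x (x ∷ []) w [] refl [])

  lrGo-absorb : ∀ m acc t rest → All (m ≤_) t → lrGo m acc (t ++ rest) ≡ lrGo m (t ʳ++ acc) rest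
  lrGo-absorb m acc []      rest []           = refl
  lrGo-absorb m acc (x ∷ t) rest (m≤x ∷ m≤t) rewrite <ᵇ-false m≤x = lrGo-absorb m (x ∷ acc) t rest m≤t

  reverse-ʳ++ : ∀ (h : ℕ) t → reverse (t ʳ++ (h ∷ [])) ≡ h ∷ t
  reverse-ʳ++ h t = begin
    reverse (t ʳ++ h ∷ [])        ≡⟨ cong reverse (ʳ++-defn t) ⟩
    reverse (reverse t ++ h ∷ []) ≡⟨ reverse-++ (reverse t) (h ∷ []) ⟩
    h ∷ reverse (reverse t)       ≡⟨ cong (h ∷_) (reverse-involutive t) ⟩
    h ∷ t                         ∎
    where open ≡-Reasoning

  lrGo-block : ∀ h t ms → LRFamily ((h ∷ t) ∷ ms) → lrGo h (h ∷ []) (t ++ concat ms) ≡ (h ∷ t) ∷ ms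
  lrGo-emit  : ∀ m acc ms → All (λ B → first B < m) ms → LRFamily ms →
               lrGo m acc (concat ms) ≡ reverse acc ∷ ms

  lrGo-block h t ms (h≤t , heads , fam) = begin
    lrGo h (h ∷ []) (t ++ concat ms)  ≡⟨ lrGo-absorb h (h ∷ []) t (concat ms) h≤t ⟩
    lrGo h (t ʳ++ h ∷ []) (concat ms) ≡⟨ lrGo-emit h (t ʳ++ h ∷ []) ms heads fam ⟩
    reverse (t ʳ++ h ∷ []) ∷ ms       ≡⟨ cong (_∷ ms) (reverse-ʳ++ h t) ⟩
    (h ∷ t) ∷ ms                      ∎
    where open ≡-Reasoning

  lrGo-emit m acc []             _         _   = refl
  lrGo-emit m acc ((h ∷ t) ∷ ms) (h<m ∷ _) fam rewrite <ᵇ-true h<m = cong (reverse acc ∷_) (lrGo-block h t ms fam)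

  lrBlocks-concat-family : ∀ m → LRFamily m → lrBlocks (concat m) ≡ m
  lrBlocks-concat-family []            _   = refl
  lrBlocks-concat-family ((h ∷ t) ∷ m) fam = lrGo-block h t m fam

  LRFamily-⊆ : ∀ {m′ m} → m′ ⊆ m → LRFamily m → LRFamily m′
  LRFamily-⊆ []                     _                   = tt
  LRFamily-⊆ (_ ∷ʳ m′⊆m)            fam                 = LRFamily-⊆ m′⊆m (LRFamily-tail fam)
  LRFamily-⊆ (_∷_ {[]} refl m′⊆m)    ()
  LRFamily-⊆ (_∷_ {h ∷ t} refl m′⊆m) (h≤t , heads , fam) =
    h≤t , All-resp-⊆ m′⊆m heads , LRFamily-⊆ m′⊆m fam

  IncreasingOn-⊇ : ∀ {g V W} → (∀ {x} → x ∈ V → x ∈ W) → IncreasingOn g W → IncreasingOn g V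
  IncreasingOn-⊇ V⊆W inc x∈V y∈V = inc (V⊆W x∈V) (V⊆W y∈V)

  IncreasingOn-≤ : ∀ {g W x y} → IncreasingOn g W → x ∈ W → y ∈ W → x ≤ y → g x ≤ g y
  IncreasingOn-≤ inc x∈W y∈W x≤y with m≤n⇒m<n∨m≡n x≤y
  ... | inj₁ x<y  = <⇒≤ (inc x∈W y∈W x<y)
  ... | inj₂ refl = ≤-refl

  first-letters-map : ∀ {g h} ms → LRFamily ms → IncreasingOn g (h ∷ concat ms) →
                      All (λ B → first B < h) ms → All (λ B → first B < g h) (map (map g) ms)
  first-letters-map []               _             _   []              = []
  first-letters-map ((h′ ∷ t′) ∷ ms) (_ , _ , fam) inc (h′<h ∷ heads) =
    inc (there (here refl)) (here refl) h′<h ∷ first-letters-map ms fam (IncreasingOn-⊇ skip inc) heads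
    where
    skip : ∀ {h x} → x ∈ h ∷ concat ms → x ∈ h ∷ h′ ∷ t′ ++ concat ms
    skip (here x≡h)  = here x≡h
    skip (there x∈m) = there (there (∈-++⁺ʳ t′ x∈m))

  LRFamily-map : ∀ {g} m → LRFamily m → IncreasingOn g (concat m) → LRFamily (map (map g) m)
  LRFamily-map []            _                   _   = tt
  LRFamily-map ((h ∷ t) ∷ m) (h≤t , heads , fam) inc =
    AllP.map⁺ (All.tabulate (λ x∈t → IncreasingOn-≤ inc (here refl) (there (∈-++⁺ˡ x∈t))
                                                    (All.lookup h≤t x∈t))) ,
    first-letters-map m fam (IncreasingOn-⊇ skip inc) heads ,
    LRFamily-map m fam (IncreasingOn-⊇ (λ x∈m → there (∈-++⁺ʳ t x∈m)) inc)
    where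
    skip : ∀ {x} → x ∈ h ∷ concat m → x ∈ h ∷ t ++ concat m
    skip (here x≡h)  = here x≡h
    skip (there x∈m) = there (∈-++⁺ʳ t x∈m)

  subwordOf-⊆ : ∀ {l′ l} → l′ ⊆ l → subwordOf l′ ⊆ subwordOf l
  subwordOf-⊆ l′⊆l = concat⁺ (Hetero.map (λ { refl → ⊆-refl }) (reverse⁺ l′⊆l))

  subwordOf-F : ∀ a → subwordOf (F a) ≡ a
  subwordOf-F a = trans (cong concat (reverse-involutive (lrBlocks a))) (lrBlocks-concat a)

  subwordOf-map : ∀ g l → subwordOf (map (map g) l) ≡ map g (subwordOf l)
  subwordOf-map g l = trans (cong concat (sym (reverse-map (map g) l))) (concat-map (reverse l))

  F-subfamily : ∀ a {l} → l ⊆ F a → LRFamily (reverse l)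
  F-subfamily a {l} l⊆F =
    LRFamily-⊆ (subst (reverse l ⊆_) (reverse-involutive (lrBlocks a)) (reverse⁺ l⊆F)) (lrBlocks-family a)

  Pos-subword : ∀ a {l} → Pos a → l ⊆ F a → Pos (subwordOf l)
  Pos-subword a pos l⊆F = All-resp-⊆ (subwordOf-⊆ l⊆F) (subst Pos (sym (subwordOf-F a)) pos)

  F-nonempty : ∀ a → All (λ w → 1 ≤ length w) (F a)
  F-nonempty a = All.tabulate (λ w∈F → All.lookup (LRFamily-nonempty _ (lrBlocks-family a)) (AnyP.reverse⁻ w∈F))

  F-Park : ∀ l (pos : Pos (subwordOf l)) → LRFamily (reverse l) →
           F (Park (subwordOf l)) ≡ map (map (Relabelling.g (relabelling (subwordOf l) pos))) l
  F-Park l pos fam = begin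
    F (Park u)                                            ≡⟨ cong F R.Park≡map ⟩
    reverse (lrBlocks (map g (concat (reverse l))))       ≡⟨ cong (reverse ∘ lrBlocks) (sym (concat-map (reverse l))) ⟩
    reverse (lrBlocks (concat (map (map g) (reverse l)))) ≡⟨ cong reverse (lrBlocks-concat-family _ relabelled) ⟩
    reverse (map (map g) (reverse l))                     ≡⟨ sym (reverse-map (map g) (reverse l)) ⟩
    map (map g) (reverse (reverse l))                     ≡⟨ cong (map (map g)) (reverse-involutive l) ⟩
    map (map g) l                                         ∎
    where
    open ≡-Reasoning
    u = subwordOf l
    module R = Relabelling (relabelling u pos)
    g = R.g
    relabelled : LRFamily (map (map g) (reverse l))
    relabelled = LRFamily-map (reverse l) fam R.increasing

  Split : Set
  Split = List Word × List Word

  addˡ addʳ : Word → Split → Split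
  addˡ w (l , r) = (w ∷ l , r)
  addʳ w (l , r) = (l , w ∷ r)

  mapSplit : (Word → Word) → Split → Split
  mapSplit φ (l , r) = (map φ l , map φ r)

  splits-⊆ : ∀ ws → All (λ (l , r) → l ⊆ ws × r ⊆ ws) (splits ws)
  splits-⊆ []       = ([] , []) ∷ []
  splits-⊆ (w ∷ ws) = AllP.++⁺ (AllP.map⁺ (All.map (λ (l⊆ , r⊆) → refl ∷ l⊆ , w ∷ʳ r⊆) (splits-⊆ ws)))
                               (AllP.map⁺ (All.map (λ (l⊆ , r⊆) → w ∷ʳ l⊆ , refl ∷ r⊆) (splits-⊆ ws)))

  splits-map : ∀ (φ : Word → Word) ws → splits (map φ ws) ≡ map (mapSplit φ) (splits ws)
  splits-map φ []       = refl
  splits-map φ (w ∷ ws) = begin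
    map (addˡ (φ w)) (splits (map φ ws)) ++ map (addʳ (φ w)) (splits (map φ ws))
      ≡⟨ cong (λ S → map (addˡ (φ w)) S ++ map (addʳ (φ w)) S) (splits-map φ ws) ⟩
    map (addˡ (φ w)) (map (mapSplit φ) S) ++ map (addʳ (φ w)) (map (mapSplit φ) S)
      ≡⟨ cong₂ _++_ (trans (sym (map-∘ S)) (map-∘ S)) (trans (sym (map-∘ S)) (map-∘ S)) ⟩
    map (mapSplit φ) (map (addˡ w) S) ++ map (mapSplit φ) (map (addʳ w) S)
      ≡⟨ sym (map-++ (mapSplit φ) (map (addˡ w) S) (map (addʳ w) S)) ⟩
    map (mapSplit φ) (splits (w ∷ ws)) ∎
    where
    open ≡-Reasoning
    S = splits ws

  parkSub : List Word → Word
  parkSub l = Park (subwordOf l)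

  parkPair : Split → Word × Word
  parkPair (l , r) = (parkSub l , parkSub r)

  parkSub-F : ∀ a → IsParking a → parkSub (F a) ≡ a
  parkSub-F a pf = trans (cong Park (subwordOf-F a)) (Park-id a pf)

  Δ-closed : ∀ a → IsParking a → All (λ (x , y) → IsParking x × IsParking y) (Δ a)
  Δ-closed a pf = AllP.map⁺ (All.map (λ (l⊆F , r⊆F) → Park-IsParking _ (Pos-subword a pos l⊆F) ,
                                                    Park-IsParking _ (Pos-subword a pos r⊆F))
                                     (splits-⊆ (F a)))
    where pos = IsParking⇒Pos a pf

  -- The coproduct of a parkized subword is computed by splitting the
  -- subfamily itself: the LR-decomposition of parkSub l is l relabelled,
  -- and relabelling does not change the parkized subwords.
  Δ-parkSub : ∀ a → Pos a → ∀ {l} → l ⊆ F a → Δ (parkSub l) ≡ map parkPair (splits l)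
  Δ-parkSub a pos {l} l⊆F = begin
    map parkPair (splits (F (parkSub l)))              ≡⟨ cong (map parkPair ∘ splits) (F-Park l posl fam) ⟩
    map parkPair (splits (map (map R.g) l))            ≡⟨ cong (map parkPair) (splits-map (map R.g) l) ⟩
    map parkPair (map (mapSplit (map R.g)) (splits l)) ≡⟨ sym (map-∘ (splits l)) ⟩
    map (parkPair ∘ mapSplit (map R.g)) (splits l)     ≡⟨ map-cong-local (All.map unrelabel-pair (splits-⊆ l)) ⟩
    map parkPair (splits l)                            ∎
    where
    open ≡-Reasoning
    posl = Pos-subword a pos l⊆F
    fam  = F-subfamily a l⊆F
    module R = Relabelling (relabelling (subwordOf l) posl)
    unrelabel : ∀ {x} → x ⊆ l → parkSub (map (map R.g) x) ≡ parkSub x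
    unrelabel {x} x⊆l = trans (cong Park (subwordOf-map R.g x)) (R.park-subwords (subwordOf-⊆ x⊆l))
    unrelabel-pair : ∀ {x y} → x ⊆ l × y ⊆ l → parkPair (mapSplit (map R.g) (x , y)) ≡ parkPair (x , y)
    unrelabel-pair (x⊆l , y⊆l) = cong₂ _,_ (unrelabel x⊆l) (unrelabel y⊆l)

  parkSub-nonempty : ∀ {w} l → 1 ≤ length w → 1 ≤ length (parkSub (w ∷ l))
  parkSub-nonempty {w} l 1≤w = begin
    1                                ≤⟨ 1≤w ⟩
    length w                         ≡⟨ cong length (sym (++-identityʳ w)) ⟩
    length (subwordOf (w ∷ []))      ≤⟨ length-mono-≤ (subwordOf-⊆ (refl ∷ minimum l)) ⟩
    length (subwordOf (w ∷ l))       ≡⟨ length-Park (subwordOf (w ∷ l)) ⟨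
    length (parkSub (w ∷ l))         ∎
    where open ≤-Reasoning


module SplitSums {c ℓ} (K : CommutativeRing c ℓ) where
  open LRDecomposition using (Split; addˡ; addʳ)
  open import Data.List using (List; []; _∷_; map; _++_)
  open import Data.List.Properties using (map-∘)
  open import Data.List.Relation.Unary.All using (All; []; _∷_)
  import Data.List.Relation.Unary.All as All
  open import Data.Product using (_,_; swap)
  open import Function using (_∘_)
  open import Relation.Binary.PropositionalEquality using (_≡_; sym; cong; cong₂)
  open CommutativeRing K
    renaming (Carrier to R; refl to ≈-refl; sym to ≈-sym; trans to ≈-trans)
  open import Algebra.Properties.CommutativeSemigroup +-commutativeSemigroup using (interchange)
  open import Relation.Binary.Reasoning.Setoid setoid

  ∑ : {A : Set} → List A → (A → R) → R
  ∑ xs f = sumK K (map f xs)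

  ∑-map : ∀ {A B : Set} (g : A → B) xs (f : B → R) → ∑ (map g xs) f ≡ ∑ xs (f ∘ g)
  ∑-map g xs f = cong (sumK K) (sym (map-∘ xs))

  ∑-++ : ∀ {A : Set} xs ys (f : A → R) → ∑ (xs ++ ys) f ≈ ∑ xs f + ∑ ys f
  ∑-++ []       ys f = ≈-sym (+-identityˡ _)
  ∑-++ (x ∷ xs) ys f = ≈-trans (+-congˡ (∑-++ xs ys f)) (≈-sym (+-assoc _ _ _))

  ∑-cong : ∀ {A : Set} {f g : A → R} {xs} → All (λ x → f x ≈ g x) xs → ∑ xs f ≈ ∑ xs g
  ∑-cong []           = ≈-refl
  ∑-cong (fx≈gx ∷ eq) = +-cong fx≈gx (∑-cong eq)

  ∑-congᵘ : ∀ {A : Set} {f g : A → R} xs → (∀ x → f x ≈ g x) → ∑ xs f ≈ ∑ xs g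
  ∑-congᵘ xs f≈g = ∑-cong (All.universal f≈g xs)

  ∑-+ : ∀ {A : Set} xs (f g : A → R) → ∑ xs (λ x → f x + g x) ≈ ∑ xs f + ∑ xs g
  ∑-+ []       f g = ≈-sym (+-identityˡ _)
  ∑-+ (x ∷ xs) f g = ≈-trans (+-congˡ (∑-+ xs f g)) (interchange _ _ _ _)

  ∑-*ʳ : ∀ {A : Set} xs (f : A → R) a → ∑ xs f * a ≈ ∑ xs (λ x → f x * a)
  ∑-*ʳ []       f a = zeroˡ a
  ∑-*ʳ (x ∷ xs) f a = ≈-trans (distribʳ a _ _) (+-congˡ (∑-*ʳ xs f a))

  ∑-*ˡ : ∀ {A : Set} xs (f : A → R) a → a * ∑ xs f ≈ ∑ xs (λ x → a * f x)
  ∑-*ˡ []       f a = zeroʳ a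
  ∑-*ˡ (x ∷ xs) f a = ≈-trans (distribˡ a _ _) (+-congˡ (∑-*ˡ xs f a))

  ∑-zero : ∀ {A : Set} xs (f : A → R) → (∀ x → f x ≈ 0#) → ∑ xs f ≈ 0#
  ∑-zero []       f f≈0 = ≈-refl
  ∑-zero (x ∷ xs) f f≈0 = ≈-trans (+-cong (f≈0 x) (∑-zero xs f f≈0)) (+-identityˡ 0#)

  ∑-splits-∷ : ∀ w ws (f : Split → R) →
               ∑ (splits (w ∷ ws)) f ≈ ∑ (splits ws) (f ∘ addˡ w) + ∑ (splits ws) (f ∘ addʳ w)
  ∑-splits-∷ w ws f = begin
    ∑ (map (addˡ w) S ++ map (addʳ w) S) f           ≈⟨ ∑-++ (map (addˡ w) S) (map (addʳ w) S) f ⟩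
    ∑ (map (addˡ w) S) f + ∑ (map (addʳ w) S) f      ≡⟨ cong₂ _+_ (∑-map (addˡ w) S f) (∑-map (addʳ w) S f) ⟩
    ∑ S (f ∘ addˡ w) + ∑ S (f ∘ addʳ w)              ∎
    where S = splits ws

  ∑-splits-swap : ∀ ws (f : Split → R) → ∑ (splits ws) f ≈ ∑ (splits ws) (f ∘ swap)
  ∑-splits-swap []       f = ≈-refl
  ∑-splits-swap (w ∷ ws) f = begin
    ∑ (splits (w ∷ ws)) f
      ≈⟨ ∑-splits-∷ w ws f ⟩
    ∑ (splits ws) (f ∘ addˡ w) + ∑ (splits ws) (f ∘ addʳ w)
      ≈⟨ +-cong (∑-splits-swap ws _) (∑-splits-swap ws _) ⟩
    ∑ (splits ws) (f ∘ addˡ w ∘ swap) + ∑ (splits ws) (f ∘ addʳ w ∘ swap)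
      ≈⟨ +-comm _ _ ⟩
    ∑ (splits ws) (f ∘ addʳ w ∘ swap) + ∑ (splits ws) (f ∘ addˡ w ∘ swap)
      ≈⟨ ∑-splits-∷ w ws (f ∘ swap) ⟨
    ∑ (splits (w ∷ ws)) (f ∘ swap) ∎

  -- Splitting first ws = l ⊎ r and then l = x ⊎ y, or first ws = l ⊎ r and
  -- then r = y ⊎ z: both enumerate the ordered partitions ws = x ⊎ y ⊎ z.
  splitLeft splitRight : List Word → (List Word → List Word → List Word → R) → R
  splitLeft  ws h = ∑ (splits ws) (λ (l , r) → ∑ (splits l) (λ (x , y) → h x y r))
  splitRight ws h = ∑ (splits ws) (λ (l , r) → ∑ (splits r) (λ (y , z) → h l y z))

  ∑-splits-assoc : ∀ ws h → splitLeft ws h ≈ splitRight ws h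
  ∑-splits-assoc []       h = ≈-refl
  ∑-splits-assoc (w ∷ ws) h = begin
    splitLeft (w ∷ ws) h
      ≈⟨ ∑-splits-∷ w ws _ ⟩
    ∑ S (λ (l , r) → ∑ (splits (w ∷ l)) (λ (x , y) → h x y r)) + splitLeft ws h₃
      ≈⟨ +-congʳ (∑-congᵘ S (λ (l , r) → ∑-splits-∷ w l _)) ⟩
    ∑ S (λ (l , r) → ∑ (splits l) (λ (x , y) → h₁ x y r) + ∑ (splits l) (λ (x , y) → h₂ x y r)) + splitLeft ws h₃
      ≈⟨ +-congʳ (∑-+ S _ _) ⟩
    (splitLeft ws h₁ + splitLeft ws h₂) + splitLeft ws h₃
      ≈⟨ +-cong (+-cong (∑-splits-assoc ws h₁) (∑-splits-assoc ws h₂)) (∑-splits-assoc ws h₃) ⟩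
    (splitRight ws h₁ + splitRight ws h₂) + splitRight ws h₃
      ≈⟨ +-assoc _ _ _ ⟩
    splitRight ws h₁ + (splitRight ws h₂ + splitRight ws h₃)
      ≈⟨ +-congˡ (∑-+ S _ _) ⟨
    splitRight ws h₁ + ∑ S (λ (l , r) → ∑ (splits r) (λ (y , z) → h₂ l y z) + ∑ (splits r) (λ (y , z) → h₃ l y z))
      ≈⟨ +-congˡ (∑-congᵘ S (λ (l , r) → ∑-splits-∷ w r _)) ⟨
    splitRight ws h₁ + ∑ S (λ (l , r) → ∑ (splits (w ∷ r)) (λ (y , z) → h l y z))
      ≈⟨ ∑-splits-∷ w ws _ ⟨
    splitRight (w ∷ ws) h ∎
    where
    S = splits ws
    h₁ h₂ h₃ : List Word → List Word → List Word → R
    h₁ x y z = h (w ∷ x) y z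
    h₂ x y z = h x (w ∷ y) z
    h₃ x y z = h x y (w ∷ z)

  ∑-splits-counit : ∀ ws (φ ψ : List Word → R) → φ [] ≈ 1# → All (λ w → ∀ l → φ (w ∷ l) ≈ 0#) ws →
                    ∑ (splits ws) (λ (l , r) → φ l * ψ r) ≈ ψ ws
  ∑-splits-counit []       φ ψ φ[]≈1 [] =
    ≈-trans (+-identityʳ _) (≈-trans (*-congʳ φ[]≈1) (*-identityˡ _))
  ∑-splits-counit (w ∷ ws) φ ψ φ[]≈1 (φw≈0 ∷ φws≈0) = begin
    ∑ (splits (w ∷ ws)) (λ (l , r) → φ l * ψ r)
      ≈⟨ ∑-splits-∷ w ws _ ⟩
    ∑ (splits ws) (λ (l , r) → φ (w ∷ l) * ψ r) + ∑ (splits ws) (λ (l , r) → φ l * ψ (w ∷ r))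
      ≈⟨ +-cong (∑-zero (splits ws) _ (λ (l , r) → ≈-trans (*-congʳ (φw≈0 l)) (zeroˡ _)))
                (∑-splits-counit ws φ (λ r → ψ (w ∷ r)) φ[]≈1 φws≈0) ⟩
    0# + ψ (w ∷ ws)
      ≈⟨ +-identityˡ _ ⟩
    ψ (w ∷ ws) ∎

module CoalgebraAxioms {c ℓ} (K : CommutativeRing c ℓ) where
  open Parkization using (Pos; IsParking⇒Pos)
  open LRDecomposition
  open SplitSums K
  open CommutativeRing K
    renaming (Carrier to R; refl to ≈-refl; sym to ≈-sym; trans to ≈-trans; reflexive to ≈-reflexive)
  open import Data.Nat using (_≤_)
  open import Data.List using (List; _∷_; length)
  open import Data.List.Relation.Unary.All using (All)
  import Data.List.Relation.Unary.All as All
  open import Data.Product using (_×_; _,_)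
  open import Data.List.Relation.Binary.Sublist.Propositional using (_⊆_)
  open import Function using (_∘_)
  open import Relation.Binary.PropositionalEquality using (_≡_; cong)
  open import Relation.Binary.Reasoning.Setoid setoid

  ∑-Δ : ∀ a (f : Word × Word → R) → ∑ (Δ a) f ≡ ∑ (splits (F a)) (f ∘ parkPair)
  ∑-Δ a f = ∑-map parkPair (splits (F a)) f

  ∑-Δ-parkSub : ∀ a → Pos a → ∀ {l} → l ⊆ F a → ∀ (f : Word × Word → R) →
                ∑ (Δ (parkSub l)) f ≡ ∑ (splits l) (f ∘ parkPair)
  ∑-Δ-parkSub a pos {l} l⊆F f rewrite Δ-parkSub a pos l⊆F = ∑-map parkPair (splits l) f

  coefΔ-parkSub : ∀ a → Pos a → ∀ {l} → l ⊆ F a → ∀ b b′ →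
                  coefΔ K (parkSub l) b b′ ≈ ∑ (splits l) (λ (x , y) → δ K (parkSub x) b * δ K (parkSub y) b′)
  coefΔ-parkSub a pos l⊆F b b′ = ≈-reflexive (∑-Δ-parkSub a pos l⊆F _)

  -- Both sides of coassociativity are sums over the ordered partitions of F a
  -- into three subfamilies.
  coassociative : ∀ a → IsParking a → ∀ b b′ b″ → coefΔid K a b b′ b″ ≈ coefidΔ K a b b′ b″
  coassociative a pf b b′ b″ = begin
    coefΔid K a b b′ b″
      ≡⟨ ∑-Δ a _ ⟩
    ∑ (splits (F a)) (λ (l , r) → coefΔ K (parkSub l) b b′ * δ K (parkSub r) b″)
      ≈⟨ ∑-cong (All.map (λ (l⊆F , _) → *-congʳ (coefΔ-parkSub a pos l⊆F b b′)) (splits-⊆ (F a))) ⟩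
    ∑ (splits (F a)) (λ (l , r) → ∑ (splits l) (λ (x , y) → δ K (parkSub x) b * δ K (parkSub y) b′) * δ K (parkSub r) b″)
      ≈⟨ ∑-congᵘ (splits (F a)) (λ (l , r) → ∑-*ʳ (splits l) _ _) ⟩
    splitLeft (F a) h
      ≈⟨ ∑-splits-assoc (F a) h ⟩
    splitRight (F a) h
      ≈⟨ ∑-congᵘ (splits (F a)) (λ (l , r) → factor-out l r) ⟩
    ∑ (splits (F a)) (λ (l , r) → δ K (parkSub l) b * ∑ (splits r) (λ (y , z) → δ K (parkSub y) b′ * δ K (parkSub z) b″))
      ≈⟨ ∑-cong (All.map (λ (_ , r⊆F) → *-congˡ (coefΔ-parkSub a pos r⊆F b′ b″)) (splits-⊆ (F a))) ⟨
    ∑ (splits (F a)) (λ (l , r) → δ K (parkSub l) b * coefΔ K (parkSub r) b′ b″)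
      ≡⟨ ∑-Δ a _ ⟨
    coefidΔ K a b b′ b″ ∎
    where
    pos = IsParking⇒Pos a pf
    h : List Word → List Word → List Word → R
    h x y z = (δ K (parkSub x) b * δ K (parkSub y) b′) * δ K (parkSub z) b″
    factor-out : ∀ l r → ∑ (splits r) (λ (y , z) → h l y z) ≈
                         δ K (parkSub l) b * ∑ (splits r) (λ (y , z) → δ K (parkSub y) b′ * δ K (parkSub z) b″)
    factor-out l r = ≈-trans (∑-congᵘ (splits r) (λ _ → *-assoc _ _ _)) (≈-sym (∑-*ˡ (splits r) _ _))

  ε-parkSub-∷ : ∀ a → All (λ w → ∀ l → ε K (parkSub (w ∷ l)) ≈ 0#) (F a)
  ε-parkSub-∷ a = All.map (λ {w} 1≤w l → ε-nonempty (parkSub (w ∷ l)) (parkSub-nonempty l 1≤w)) (F-nonempty a)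
    where
    ε-nonempty : ∀ u → 1 ≤ length u → ε K u ≈ 0#
    ε-nonempty (_ ∷ _) _ = ≈-refl

  -- Only the splitting (∅ , F a) survives ε, and it contributes M_a.
  counitˡ : ∀ a → IsParking a → ∀ b → coefεid K a b ≈ δ K a b
  counitˡ a pf b = begin
    coefεid K a b
      ≡⟨ ∑-Δ a _ ⟩
    ∑ (splits (F a)) (λ (l , r) → ε K (parkSub l) * δ K (parkSub r) b)
      ≈⟨ ∑-splits-counit (F a) (ε K ∘ parkSub) (λ r → δ K (parkSub r) b) ≈-refl (ε-parkSub-∷ a) ⟩
    δ K (parkSub (F a)) b
      ≡⟨ cong (λ x → δ K x b) (parkSub-F a pf) ⟩
    δ K a b ∎

  -- The right counit law is the left one after exchanging the two sides.
  counitʳ : ∀ a → IsParking a → ∀ b → coefidε K a b ≈ δ K a b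
  counitʳ a pf b = begin
    coefidε K a b
      ≡⟨ ∑-Δ a _ ⟩
    ∑ (splits (F a)) (λ (l , r) → δ K (parkSub l) b * ε K (parkSub r))
      ≈⟨ ∑-splits-swap (F a) _ ⟩
    ∑ (splits (F a)) (λ (l , r) → δ K (parkSub r) b * ε K (parkSub l))
      ≈⟨ ∑-congᵘ (splits (F a)) (λ _ → *-comm _ _) ⟩
    ∑ (splits (F a)) (λ (l , r) → ε K (parkSub l) * δ K (parkSub r) b)
      ≡⟨ ∑-Δ a _ ⟨
    coefεid K a b
      ≈⟨ counitˡ a pf b ⟩
    δ K a b ∎

  -- Exchanging the two sides of every splitting exchanges b and b′.
  cocommutative : ∀ a → ∀ b b′ → coefΔ K a b b′ ≈ coefΔ K a b′ b
  cocommutative a b b′ = begin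
    coefΔ K a b b′
      ≡⟨ ∑-Δ a _ ⟩
    ∑ (splits (F a)) (λ (l , r) → δ K (parkSub l) b * δ K (parkSub r) b′)
      ≈⟨ ∑-splits-swap (F a) _ ⟩
    ∑ (splits (F a)) (λ (l , r) → δ K (parkSub r) b * δ K (parkSub l) b′)
      ≈⟨ ∑-congᵘ (splits (F a)) (λ _ → *-comm _ _) ⟩
    ∑ (splits (F a)) (λ (l , r) → δ K (parkSub l) b′ * δ K (parkSub r) b)
      ≡⟨ ∑-Δ a _ ⟨
    coefΔ K a b′ b ∎

proposition3p3 : ∀ {c ℓ} (K : CommutativeRing c ℓ) → IsField K → CharZero K → IsCocommCoalgebra K
proposition3p3 K _ _ =
  LRDecomposition.Δ-closed , coassociative , counitˡ , counitʳ , (λ a _ → cocommutative a)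
  where open CoalgebraAxioms K
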